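{- Let $s\ge 2$ and let $H_1,\dots,H_s$ be pairwise vertex-disjoint connected finite simple graphs. Assume that for each $1\le i\le s$, $\mathrm{ind\text{ - }match}(H_i)=1$ and $H_i$ satisfies one of: (a) there is a vertex $v_i\in V(H_i)$ having a neighbor $w\in V(H_i)$ with $\deg_{H_i}(w)=1$; or (b) $H_i$ is a complete bipartite graph, in which case $v_i\in V(H_i)$ is chosen arbitrarily. Let $v$ be a new vertex and let $G$ be the graph with $V(G)=\bigcup_{i=1}^s V(H_i)\cup\{v\}$ and $E(G)=\bigcup_{i=1}^s E(H_i)\cup\{\{v_i,v\}:1\le i\le s\}$. Then $\mathrm{ind\text{ - }match}(G)=s$.
   Context: A matching is a set of pairwise disjoint edges; an induced matching is a matching $M$ such that for distinct $e,f\in M$ there is no edge $g$ of the graph meeting both $e$ and $f$. $\mathrm{ind\text{ - }match}$ denotes the maximum size of an induced matching. -}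

module Defs where

open import Data.Nat using (ℕ; zero; suc; _≤_)
open import Data.Fin using (Fin) renaming (_≟_ to _≟ᶠ_)
open import Data.Bool using (Bool; true; false; if_then_else_)
open import Data.List using (List; map; allFin)
open import Data.Nat.ListAction using (sum)
open import Data.Product using (Σ; _×_; _,_; ∃)
open import Data.Sum using (_⊎_; inj₁; inj₂)
open import Data.Unit using (⊤; tt)
open import Relation.Nullary using (¬_; yes; no)
open import Relation.Nullary.Decidable using (isYes)
open import Relation.Binary.PropositionalEquality using (_≡_; refl; _≢_)

record Graph (V : Set) : Set where
  constructor mkGraph
  field
    adj : V → V → Bool
open Graph public

IsSimple : {V : Set} → Graph V → Set
IsSimple {V} G = (∀ (x y : V) → adj G x y ≡ adj G y x) × (∀ (x : V) → adj G x x ≡ false)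

data Reach {V : Set} (G : Graph V) (x : V) : V → Set where
  here : Reach G x x
  step : ∀ {y z} → Reach G x y → adj G y z ≡ true → Reach G x z

Connected : {V : Set} → Graph V → Set
Connected {V} G = ∀ (x y : V) → Reach G x y

deg : {n : ℕ} → Graph (Fin n) → Fin n → ℕ
deg {n} G w = sum (map (λ u → if adj G w u then 1 else 0) (allFin n))

IsCompleteBipartite : {n : ℕ} → Graph (Fin n) → Set
IsCompleteBipartite {n} G =
  Σ (Fin n → Bool) λ c → ∀ (x y : Fin n) → (adj G x y ≡ true → c x ≢ c y) × (c x ≢ c y → adj G x y ≡ true)

Endpoint : {V : Set} → V × V → V → Set
Endpoint (a , b) x = (x ≡ a) ⊎ (x ≡ b)

IsEdge : {V : Set} → Graph V → V × V → Set
IsEdge G (a , b) = adj G a b ≡ true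

IsInducedMatching : {V : Set} → Graph V → (k : ℕ) → (Fin k → V × V) → Set
IsInducedMatching {V} G k M =
  (∀ i → IsEdge G (M i)) ×
  (∀ i j → i ≢ j → ∀ (x y : V) → Endpoint (M i) x → Endpoint (M j) y →
      (x ≢ y) × (adj G x y ≡ false))

HasInducedMatching : {V : Set} → Graph V → ℕ → Set
HasInducedMatching {V} G k = Σ (Fin k → V × V) (IsInducedMatching G k)

IndMatchIs : {V : Set} → Graph V → ℕ → Set
IndMatchIs G k = HasInducedMatching G k × (∀ m → HasInducedMatching G m → m ≤ k)

-- The glued graph: disjoint union of H₁,…,Hₛ plus a new vertex v (inj₂ tt),
-- with extra edges {vᵢ , v}.
GlueV : (s : ℕ) → (Fin s → ℕ) → Set
GlueV s n = Σ (Fin s) (λ i → Fin (n i)) ⊎ ⊤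

glueAdj : (s : ℕ) (n : Fin s → ℕ) → ((i : Fin s) → Graph (Fin (n i))) →
          ((i : Fin s) → Fin (n i)) → GlueV s n → GlueV s n → Bool
glueAdj s n H v (inj₁ (i , a)) (inj₁ (j , b)) with i ≟ᶠ j
... | yes refl = adj (H i) a b
... | no _ = false
glueAdj s n H v (inj₁ (i , a)) (inj₂ tt) = isYes (a ≟ᶠ v i)
glueAdj s n H v (inj₂ tt) (inj₁ (j , b)) = isYes (b ≟ᶠ v j)
glueAdj s n H v (inj₂ tt) (inj₂ tt) = false

glue : (s : ℕ) (n : Fin s → ℕ) → ((i : Fin s) → Graph (Fin (n i))) →
       ((i : Fin s) → Fin (n i)) → Graph (GlueV s n)
glue s n H v = mkGraph (glueAdj s n H v)

{-# OPTIONS --safe #-}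
-- Every edge of G lies in a block: inside some Hᵢ, or on the spoke {vᵢ, v}.
-- Choosing one edge in each Hᵢ gives an induced matching of size s, since no
-- edge of G joins distinct Hᵢ. Conversely, two edges of an induced matching
-- lie in distinct blocks: two spokes share v, two edges of Hᵢ would contradict
-- ind-match(Hᵢ) = 1, and an edge of Hᵢ is never separated from vᵢ because vᵢ
-- dominates the edges of Hᵢ. In case (a) an edge far from vᵢ would form an
-- induced 2-matching with the pendant edge vᵢw; in case (b) one endpoint of
-- each edge lies in the colour class opposite to vᵢ, hence is adjacent to vᵢ.
module Submission where

open import Defs
open import Data.Nat using (ℕ; _≤_; _+_; s≤s)
open import Data.Nat.Properties using (≤-trans; ≤-refl; +-mono-≤; +-comm; m≤m+n; m≤n+m)
open import Data.Nat.ListAction using (sum)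
open import Data.Fin using (Fin; zero; suc) renaming (_≟_ to _≟ᶠ_)
open import Data.Fin.Properties using (injective⇒≤)
open import Data.Bool using (true; false; if_then_else_) renaming (_≟_ to _≟ᵇ_)
open import Data.List using (tabulate)
open import Data.List.Properties using (map-tabulate)
open import Data.Product using (Σ; _×_; _,_; proj₁; proj₂)
open import Data.Product.Properties using (,-injectiveˡ)
open import Data.Sum using (_⊎_; inj₁; inj₂)
open import Data.Sum.Properties using (inj₁-injective)
open import Data.Unit using (tt)
open import Relation.Nullary using (¬_; yes; no; contradiction)
open import Relation.Binary.PropositionalEquality
  using (_≡_; _≢_; refl; sym; trans; cong; subst)

private
  variable
    V W : Set

g≤sum-tabulate : ∀ {n} (g : Fin n → ℕ) (u : Fin n) → g u ≤ sum (tabulate g)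
g≤sum-tabulate g zero    = m≤m+n (g zero) _
g≤sum-tabulate g (suc u) = ≤-trans (g≤sum-tabulate (λ k → g (suc k)) u) (m≤n+m _ (g zero))

g+g≤sum-tabulate : ∀ {n} (g : Fin n → ℕ) {u u′ : Fin n} → u ≢ u′ →
                   g u + g u′ ≤ sum (tabulate g)
g+g≤sum-tabulate g {zero}  {zero}   u≢u′ = contradiction refl u≢u′
g+g≤sum-tabulate g {zero}  {suc u′} u≢u′ =
  +-mono-≤ (≤-refl {g zero}) (g≤sum-tabulate (λ k → g (suc k)) u′)
g+g≤sum-tabulate g {suc u} {zero}   u≢u′ =
  subst (_≤ sum (tabulate g)) (+-comm (g zero) (g (suc u)))
        (+-mono-≤ (≤-refl {g zero}) (g≤sum-tabulate (λ k → g (suc k)) u))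
g+g≤sum-tabulate g {suc u} {suc u′} u≢u′ =
  ≤-trans (g+g≤sum-tabulate (λ k → g (suc k)) (λ u≡u′ → u≢u′ (cong suc u≡u′)))
          (m≤n+m _ (g zero))

deg≡1⇒neighbour-unique : ∀ {n} (H : Graph (Fin n)) {w p q : Fin n} → deg H w ≡ 1 →
                         adj H w p ≡ true → adj H w q ≡ true → p ≡ q
deg≡1⇒neighbour-unique {n} H {w} {p} {q} deg≡1 wp wq with p ≟ᶠ q
... | yes p≡q = p≡q
... | no p≢q  = contradiction (≤-trans 2≤g+g (≤-trans (g+g≤sum-tabulate g p≢q) sum≤1)) λ { (s≤s ()) }
  where
  g : Fin n → ℕ
  g u = if adj H w u then 1 else 0

  2≤g+g : 2 ≤ g p + g q
  2≤g+g rewrite wp | wq = ≤-refl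

  sum≤1 : sum (tabulate g) ≤ 1
  sum≤1 = subst (_≤ 1) (cong sum (map-tabulate (λ u → u) g)) (subst (deg H w ≤_) deg≡1 ≤-refl)

Separated : Graph V → V × V → V × V → Set
Separated {V} G e e′ = ∀ (x y : V) → Endpoint e x → Endpoint e′ y → (x ≢ y) × (adj G x y ≡ false)

Symmetric : Graph V → Set
Symmetric {V} G = ∀ (x y : V) → adj G x y ≡ adj G y x

separated-sym : (G : Graph V) → Symmetric G → ∀ {e e′} → Separated G e e′ → Separated G e′ e
separated-sym G sym-G sep x y x∈e′ y∈e =
  (λ x≡y → proj₁ (sep y x y∈e x∈e′) (sym x≡y)) , trans (sym-G x y) (proj₂ (sep y x y∈e x∈e′))

separated-vertexʳ : (G : Graph V) {e e′ : V × V} {u : V} → Endpoint e′ u →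
                    Separated G e e′ → Separated G e (u , u)
separated-vertexʳ G u∈e′ sep x y x∈e (inj₁ refl) = sep x y x∈e u∈e′
separated-vertexʳ G u∈e′ sep x y x∈e (inj₂ refl) = sep x y x∈e u∈e′

endpoint-map : (f : V → W) {a b x : V} → Endpoint (a , b) x → Endpoint (f a , f b) (f x)
endpoint-map f (inj₁ refl) = inj₁ refl
endpoint-map f (inj₂ refl) = inj₂ refl

endpoint-image : (f : V → W) {a b : V} {y : W} → Endpoint (f a , f b) y → Σ V λ x → y ≡ f x
endpoint-image f (inj₁ refl) = _ , refl
endpoint-image f (inj₂ refl) = _ , refl

separated-pullback : (G : Graph V) (G′ : Graph W) (f : V → W) →
                     (∀ x y → adj G′ (f x) (f y) ≡ adj G x y) →
                     ∀ {a b a′ b′} → Separated G′ (f a , f b) (f a′ , f b′) →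
                     Separated G (a , b) (a′ , b′)
separated-pullback G G′ f f-adj sep x y x∈e y∈e′ =
  (λ x≡y → proj₁ sep-f (cong f x≡y)) , trans (sym (f-adj x y)) (proj₂ sep-f)
  where
  sep-f : (f x ≢ f y) × (adj G′ (f x) (f y) ≡ false)
  sep-f = sep (f x) (f y) (endpoint-map f x∈e) (endpoint-map f y∈e′)

inducedMatching₂ : (G : Graph V) → Symmetric G → ∀ {e e′} → IsEdge G e → IsEdge G e′ →
                   Separated G e e′ → HasInducedMatching G 2
inducedMatching₂ G sym-G {e} {e′} e-edge e′-edge sep = M , edges , separated
  where
  M : Fin 2 → _
  M zero    = e
  M (suc _) = e′

  edges : ∀ i → IsEdge G (M i)
  edges zero    = e-edge
  edges (suc _) = e′-edge

  separated : ∀ i j → i ≢ j → Separated G (M i) (M j)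
  separated zero       zero       i≢j = contradiction refl i≢j
  separated zero       (suc zero) _   = sep
  separated (suc zero) zero       _   = separated-sym G sym-G sep
  separated (suc zero) (suc zero) i≢j = contradiction refl i≢j

indMatch≡1⇒¬inducedMatching₂ : (G : Graph V) → IndMatchIs G 1 → ¬ HasInducedMatching G 2
indMatch≡1⇒¬inducedMatching₂ G (_ , maximal) M₂ with maximal 2 M₂
... | s≤s ()

-- The degenerate edge (v , v) stands for the vertex v: every edge meets v or a neighbour of v.
EdgeDominating : Graph V → V → Set
EdgeDominating {V} G v = ∀ {a b : V} → adj G a b ≡ true → ¬ Separated G (a , b) (v , v)

pendantNeighbour⇒edgeDominating : ∀ {n} (H : Graph (Fin n)) {v w : Fin n} → Symmetric H →
                                  ¬ HasInducedMatching H 2 → adj H v w ≡ true → deg H w ≡ 1 →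
                                  EdgeDominating H v
pendantNeighbour⇒edgeDominating H {v} {w} sym-H no-M₂ vw deg≡1 {a} {b} ab far =
  no-M₂ (inducedMatching₂ H sym-H vw ab pendant-far)
  where
  wv : adj H w v ≡ true
  wv = trans (sym-H w v) vw

  w-far : ∀ x → Endpoint (a , b) x → (w ≢ x) × (adj H w x ≡ false)
  w-far x x∈e = (λ { refl → contradiction (trans (sym wv) (proj₂ x-far)) λ () }) , w-x≡false
    where
    x-far : (x ≢ v) × (adj H x v ≡ false)
    x-far = far x v x∈e (inj₁ refl)

    w-x≡false : adj H w x ≡ false
    w-x≡false with adj H w x in wx
    ... | false = refl
    ... | true  = contradiction (deg≡1⇒neighbour-unique H deg≡1 wx wv) (proj₁ x-far)

  pendant-far : Separated H (v , w) (a , b)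
  pendant-far x y (inj₁ refl) y∈e = separated-sym H sym-H far x y (inj₁ refl) y∈e
  pendant-far x y (inj₂ refl) y∈e = w-far y y∈e

completeBipartite⇒edgeDominating : ∀ {n} (H : Graph (Fin n)) {v : Fin n} →
                                   IsCompleteBipartite H → EdgeDominating H v
completeBipartite⇒edgeDominating H {v} (c , bipartite) {a} {b} ab far =
  proj₁ (bipartite a b) ab (trans (colour-of-v a (inj₁ refl)) (sym (colour-of-v b (inj₂ refl))))
  where
  colour-of-v : ∀ x → Endpoint (a , b) x → c x ≡ c v
  colour-of-v x x∈e with c x ≟ᵇ c v
  ... | yes cx≡cv = cx≡cv
  ... | no  cx≢cv =
    contradiction (trans (sym (proj₂ (bipartite x v) cx≢cv)) (proj₂ (far x v x∈e (inj₁ refl)))) λ ()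

edgeDominating : ∀ {n} (H : Graph (Fin n)) {v : Fin n} → Symmetric H → IndMatchIs H 1 →
                 (Σ (Fin n) (λ w → (adj H v w ≡ true) × (deg H w ≡ 1))) ⊎ IsCompleteBipartite H →
                 EdgeDominating H v
edgeDominating H sym-H im (inj₁ (_ , vw , deg≡1)) =
  pendantNeighbour⇒edgeDominating H sym-H (indMatch≡1⇒¬inducedMatching₂ H im) vw deg≡1
edgeDominating H _ _ (inj₂ complete) = completeBipartite⇒edgeDominating H complete

module Glue (s : ℕ) (n : Fin s → ℕ) (H : (i : Fin s) → Graph (Fin (n i)))
            (v : (i : Fin s) → Fin (n i)) where

  G : Graph (GlueV s n)
  G = glue s n H v

  lift : (i : Fin s) → Fin (n i) → GlueV s n
  lift i a = inj₁ (i , a)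

  hub : GlueV s n
  hub = inj₂ tt

  adj-lift : ∀ i a b → adj G (lift i a) (lift i b) ≡ adj (H i) a b
  adj-lift i a b with i ≟ᶠ i
  ... | yes refl = refl
  ... | no i≢i   = contradiction refl i≢i

  adj-lift-across : ∀ {i j} → i ≢ j → ∀ a b → adj G (lift i a) (lift j b) ≡ false
  adj-lift-across {i} {j} i≢j a b with i ≟ᶠ j
  ... | yes i≡j = contradiction i≡j i≢j
  ... | no _    = refl

  symmetric : (∀ i → Symmetric (H i)) → Symmetric G
  symmetric sym-H (inj₁ (i , a)) (inj₁ (j , b)) with i ≟ᶠ j | j ≟ᶠ i
  ... | yes refl | yes refl = sym-H i a b
  ... | yes refl | no  i≢i  = contradiction refl i≢i
  ... | no  i≢i  | yes refl = contradiction refl i≢i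
  ... | no  _    | no  _    = refl
  symmetric sym-H (inj₁ _)  (inj₂ tt) = refl
  symmetric sym-H (inj₂ tt) (inj₁ _)  = refl
  symmetric sym-H (inj₂ tt) (inj₂ tt) = refl

  separated-across : ∀ {i j} → i ≢ j → ∀ {a b a′ b′} →
                     Separated G (lift i a , lift i b) (lift j a′ , lift j b′)
  separated-across {i} {j} i≢j x y x∈e y∈e′
    with endpoint-image (lift i) x∈e | endpoint-image (lift j) y∈e′
  ... | c , refl | d , refl =
    (λ ic≡jd → i≢j (,-injectiveˡ (inj₁-injective ic≡jd))) , adj-lift-across i≢j c d

  data GlueEdge : GlueV s n × GlueV s n → Set where
    inside : ∀ i {a b} → adj (H i) a b ≡ true → GlueEdge (lift i a , lift i b)
    spoke  : ∀ i {e} → Endpoint e (lift i (v i)) → Endpoint e hub → GlueEdge e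

  block : ∀ {e} → GlueEdge e → Fin s
  block (inside i _) = i
  block (spoke i _ _) = i

  glueEdge : ∀ e → IsEdge G e → GlueEdge e
  glueEdge (inj₁ (i , a) , inj₁ (j , b)) ab with i ≟ᶠ j
  ... | yes refl = inside i ab
  glueEdge (inj₁ (i , a) , inj₁ (j , b)) () | no _
  glueEdge (inj₁ (i , a) , inj₂ tt) _ with a ≟ᶠ v i
  ... | yes refl = spoke i (inj₁ refl) (inj₂ refl)
  glueEdge (inj₁ (i , a) , inj₂ tt) () | no _
  glueEdge (inj₂ tt , inj₁ (j , b)) _ with b ≟ᶠ v j
  ... | yes refl = spoke j (inj₂ refl) (inj₁ refl)
  glueEdge (inj₂ tt , inj₁ (j , b)) () | no _
  glueEdge (inj₂ tt , inj₂ tt) ()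

  inducedMatching-s : (∀ i → HasInducedMatching (H i) 1) → HasInducedMatching G s
  inducedMatching-s M₁ = M , edges , λ i j i≢j → separated-across i≢j
    where
    edge : ∀ i → Fin (n i) × Fin (n i)
    edge i = proj₁ (M₁ i) zero

    M : Fin s → GlueV s n × GlueV s n
    M i = lift i (proj₁ (edge i)) , lift i (proj₂ (edge i))

    edges : ∀ i → IsEdge G (M i)
    edges i = trans (adj-lift i _ _) (proj₁ (proj₂ (M₁ i)) zero)

  module _ (sym-H : ∀ i → Symmetric (H i)) (no-M₂ : ∀ i → ¬ HasInducedMatching (H i) 2)
           (dominating : ∀ i → EdgeDominating (H i) (v i)) where

    inside-spoke-¬separated : ∀ i {a b e′} → adj (H i) a b ≡ true →
                              Endpoint e′ (lift i (v i)) → ¬ Separated G (lift i a , lift i b) e′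
    inside-spoke-¬separated i ab vᵢ∈e′ sep =
      dominating i ab (separated-pullback (H i) G (lift i) (adj-lift i) (separated-vertexʳ G vᵢ∈e′ sep))

    sameBlock⇒¬separated : ∀ {e e′} (ε : GlueEdge e) (ε′ : GlueEdge e′) →
                           block ε ≡ block ε′ → ¬ Separated G e e′
    sameBlock⇒¬separated (inside i ab) (inside .i ab′) refl sep =
      no-M₂ i (inducedMatching₂ (H i) (sym-H i) ab ab′
                 (separated-pullback (H i) G (lift i) (adj-lift i) sep))
    sameBlock⇒¬separated (inside i ab) (spoke .i vᵢ∈e′ _) refl sep =
      inside-spoke-¬separated i ab vᵢ∈e′ sep
    sameBlock⇒¬separated (spoke i vᵢ∈e _) (inside .i ab) refl sep =
      inside-spoke-¬separated i ab vᵢ∈e (separated-sym G (symmetric sym-H) sep)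
    sameBlock⇒¬separated (spoke _ _ hub∈e) (spoke _ _ hub∈e′) _ sep =
      proj₁ (sep hub hub hub∈e hub∈e′) refl

    inducedMatching⇒≤s : ∀ m → HasInducedMatching G m → m ≤ s
    inducedMatching⇒≤s m (M , edges , separated) = injective⇒≤ block-injective
      where
      edge : ∀ k → GlueEdge (M k)
      edge k = glueEdge (M k) (edges k)

      block-injective : ∀ {k l} → block (edge k) ≡ block (edge l) → k ≡ l
      block-injective {k} {l} same with k ≟ᶠ l
      ... | yes k≡l = k≡l
      ... | no  k≢l = contradiction (separated k l k≢l) (sameBlock⇒¬separated (edge k) (edge l) same)

theorem1p9 : (s : ℕ) → 2 ≤ s →
    (n : Fin s → ℕ) (H : (i : Fin s) → Graph (Fin (n i))) (v : (i : Fin s) → Fin (n i)) →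
    (∀ i → IsSimple (H i)) →
    (∀ i → Connected (H i)) →
    (∀ i → IndMatchIs (H i) 1) →
    (∀ i → (Σ (Fin (n i)) (λ w → (adj (H i) (v i) w ≡ true) × (deg (H i) w ≡ 1)))
           ⊎ IsCompleteBipartite (H i)) →
    IndMatchIs (glue s n H v) s
theorem1p9 s _ n H v simple _ indMatch≡1 shape =
  inducedMatching-s (λ i → proj₁ (indMatch≡1 i)) ,
  inducedMatching⇒≤s (λ i → proj₁ (simple i))
                     (λ i → indMatch≡1⇒¬inducedMatching₂ (H i) (indMatch≡1 i))
                     (λ i → edgeDominating (H i) (proj₁ (simple i)) (indMatch≡1 i) (shape i))
  where
  open Glue s n H v
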